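{- Let $n\geq2$, $\varphi_1,\dots,\varphi_n\in\mathrm{Fm}_{\mathsf S}$ and $a,b\in Ag$. If $\vdash_{\mathsf S}\varphi_i\to\varphi_{i+1}$ for all $1\leq i<n$, then $\vdash_{\mathsf S}S_{a,b}\varphi_1\land S_{a,b}\varphi_n\to\bigwedge_{i=1}^nS_{a,b}\varphi_i$.
   Context: Let $Ag$ be a non-empty finite set of agents and $Var$ a countably infinite set of propositional variables. The formulas $\mathrm{Fm}_{\mathsf S}$ are generated by $\varphi::=p\mid\neg\varphi\mid\varphi\land\varphi\mid I_a\varphi\mid K_a\varphi\mid B_a\varphi$ ($p\in Var$, $a\in Ag$), with $\lor,\to$ classical abbreviations. The logic $\mathsf S$ ($\vdash_{\mathsf S}\varphi$ means $\varphi$ is derivable) has as axioms: all classical tautologies; for each $a$ and $\star\in\{K_a,B_a,I_a\}$, $\star(\varphi\to\psi)\to(\star\varphi\to\star\psi)$; $K_a\varphi\to\varphi$; $K_a\varphi\to K_aK_a\varphi$; $B_a\varphi\to\neg B_a\neg\varphi$; $K_a\varphi\to B_a\varphi$; $B_a\varphi\to K_aB_a\varphi$; $I_a\varphi\to\neg I_a\neg\varphi$; $I_a\varphi\to K_aI_a\varphi$; $I_a\varphi\to I_aK_a\varphi$; $I_a\varphi\to I_aI_a\varphi$; rules: modus ponens and necessitation for each $K_a,B_a,I_a$. $S_{a,b}\varphi:=K_a\varphi\land B_a\neg K_b\varphi\land I_a(\varphi\land\neg K_b\varphi)$. -}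

module Defs where

open import Data.Nat using (ℕ; suc; zero)
open import Data.Fin using (Fin)
open import Data.List using (List; []; _∷_)
open import Data.Bool using (Bool; true; false; not; _∧_)
open import Relation.Binary.PropositionalEquality using (_≡_)

Var : Set
Var = ℕ

data Fm (Ag : Set) : Set where
  var  : Var → Fm Ag
  ¬′_  : Fm Ag → Fm Ag
  _∧′_ : Fm Ag → Fm Ag → Fm Ag
  I    : Ag → Fm Ag → Fm Ag
  K    : Ag → Fm Ag → Fm Ag
  B    : Ag → Fm Ag → Fm Ag

infix 7 ¬′_
infixr 6 _∧′_

module _ {Ag : Set} where

  infixr 4 _⇒_
  infixr 5 _∨′_
  infix 2 ⊢S_

  _∨′_ : Fm Ag → Fm Ag → Fm Ag
  φ ∨′ ψ = ¬′ (¬′ φ ∧′ ¬′ ψ)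

  _⇒_ : Fm Ag → Fm Ag → Fm Ag
  φ ⇒ ψ = ¬′ (φ ∧′ ¬′ ψ)

  -- Classical two-valued semantics, used to define "classical tautology"
  -- (modal subformulas are treated as atoms via an arbitrary valuation).
  record Valuation : Set where
    field
      vvar : Var → Bool
      vI vK vB : Ag → Fm Ag → Bool

  eval : Valuation → Fm Ag → Bool
  eval v (var p)  = Valuation.vvar v p
  eval v (¬′ φ)   = not (eval v φ)
  eval v (φ ∧′ ψ) = eval v φ ∧ eval v ψ
  eval v (I a φ)  = Valuation.vI v a φ
  eval v (K a φ)  = Valuation.vK v a φ
  eval v (B a φ)  = Valuation.vB v a φ

  Tautology : Fm Ag → Set
  Tautology φ = (v : Valuation) → eval v φ ≡ true

  data ⊢S_ : Fm Ag → Set where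
    taut   : ∀ {φ} → Tautology φ → ⊢S φ
    distK  : ∀ a φ ψ → ⊢S (K a (φ ⇒ ψ) ⇒ (K a φ ⇒ K a ψ))
    distB  : ∀ a φ ψ → ⊢S (B a (φ ⇒ ψ) ⇒ (B a φ ⇒ B a ψ))
    distI  : ∀ a φ ψ → ⊢S (I a (φ ⇒ ψ) ⇒ (I a φ ⇒ I a ψ))
    axT    : ∀ a φ → ⊢S (K a φ ⇒ φ)
    ax4    : ∀ a φ → ⊢S (K a φ ⇒ K a (K a φ))
    axDB   : ∀ a φ → ⊢S (B a φ ⇒ ¬′ B a (¬′ φ))
    axKB   : ∀ a φ → ⊢S (K a φ ⇒ B a φ)
    axBKB  : ∀ a φ → ⊢S (B a φ ⇒ K a (B a φ))
    axDI   : ∀ a φ → ⊢S (I a φ ⇒ ¬′ I a (¬′ φ))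
    axIKI  : ∀ a φ → ⊢S (I a φ ⇒ K a (I a φ))
    axIIK  : ∀ a φ → ⊢S (I a φ ⇒ I a (K a φ))
    axIII  : ∀ a φ → ⊢S (I a φ ⇒ I a (I a φ))
    mp     : ∀ {φ ψ} → ⊢S (φ ⇒ ψ) → ⊢S φ → ⊢S ψ
    necK   : ∀ a {φ} → ⊢S φ → ⊢S K a φ
    necB   : ∀ a {φ} → ⊢S φ → ⊢S B a φ
    necI   : ∀ a {φ} → ⊢S φ → ⊢S I a φ

  S : Ag → Ag → Fm Ag → Fm Ag
  S a b φ = K a φ ∧′ (B a (¬′ K b φ) ∧′ I a (φ ∧′ ¬′ K b φ))

  ⋀ : List (Fm Ag) → Fm Ag
  ⋀ []           = ¬′ (var 0 ∧′ ¬′ var 0)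
  ⋀ (φ ∷ [])     = φ
  ⋀ (φ ∷ ψ ∷ ψs) = φ ∧′ ⋀ (ψ ∷ ψs)

{-# OPTIONS --safe #-}
-- The provable chain φ₁ → φᵢ → φₙ transports each conjunct of S_{a,b} to φᵢ.
-- K_a φ₁ and the φ-part of I_a(φ₁ ∧ ¬K_b φ₁) move upwards along φ₁ → φᵢ by
-- monotonicity.  Contraposing K_b φᵢ → K_b φₙ gives ¬K_b φₙ → ¬K_b φᵢ, which
-- moves B_a ¬K_b φₙ and the ¬K_b-part of I_a(φₙ ∧ ¬K_b φₙ) downwards.  The two
-- halves of the intention recombine since I_a, being normal, agglomerates.
module Submission where

open import Defs
open import Data.Nat using (ℕ; suc)
open import Data.Fin using (Fin; zero; suc; fromℕ; inject₁)
open import Data.List using (List; []; _∷_; map; allFin)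
open import Data.List.Relation.Unary.All using (All; []; _∷_)
open import Data.List.Relation.Unary.All.Properties using (map⁺; tabulate⁺)
open import Data.Bool using (Bool; true; false; not; _∧_)
open import Relation.Binary.PropositionalEquality using (_≡_; refl)

module _ {Ag : Set} where

  private
    variable
      φ ψ χ : Fm Ag

  -- eval v (φ ⇒ ψ) reduces definitionally to eval v φ ⇒ᵇ eval v ψ.
  private
    _⇒ᵇ_ : Bool → Bool → Bool
    x ⇒ᵇ y = not (x ∧ not y)

    infixr 4 _⇒ᵇ_

    ⇒ᵇ-refl : ∀ x → (x ⇒ᵇ x) ≡ true
    ⇒ᵇ-refl true  = refl
    ⇒ᵇ-refl false = refl

    ⇒ᵇ-trans : ∀ x y z → ((x ⇒ᵇ y) ⇒ᵇ (y ⇒ᵇ z) ⇒ᵇ x ⇒ᵇ z) ≡ true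
    ⇒ᵇ-trans true  true  true  = refl
    ⇒ᵇ-trans true  true  false = refl
    ⇒ᵇ-trans true  false true  = refl
    ⇒ᵇ-trans true  false false = refl
    ⇒ᵇ-trans false true  true  = refl
    ⇒ᵇ-trans false true  false = refl
    ⇒ᵇ-trans false false true  = refl
    ⇒ᵇ-trans false false false = refl

    ⇒ᵇ-∧-intro : ∀ x y z → ((z ⇒ᵇ x) ⇒ᵇ (z ⇒ᵇ y) ⇒ᵇ z ⇒ᵇ x ∧ y) ≡ true
    ⇒ᵇ-∧-intro true  true  true  = refl
    ⇒ᵇ-∧-intro true  true  false = refl
    ⇒ᵇ-∧-intro true  false true  = refl
    ⇒ᵇ-∧-intro true  false false = refl
    ⇒ᵇ-∧-intro false true  true  = refl
    ⇒ᵇ-∧-intro false true  false = refl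
    ⇒ᵇ-∧-intro false false true  = refl
    ⇒ᵇ-∧-intro false false false = refl

    ∧-elimˡᵇ : ∀ x y → (x ∧ y ⇒ᵇ x) ≡ true
    ∧-elimˡᵇ true  true  = refl
    ∧-elimˡᵇ true  false = refl
    ∧-elimˡᵇ false true  = refl
    ∧-elimˡᵇ false false = refl

    ∧-elimʳᵇ : ∀ x y → (x ∧ y ⇒ᵇ y) ≡ true
    ∧-elimʳᵇ true  true  = refl
    ∧-elimʳᵇ true  false = refl
    ∧-elimʳᵇ false true  = refl
    ∧-elimʳᵇ false false = refl

    contrapositionᵇ : ∀ x y → ((x ⇒ᵇ y) ⇒ᵇ not y ⇒ᵇ not x) ≡ true
    contrapositionᵇ true  true  = refl
    contrapositionᵇ true  false = refl
    contrapositionᵇ false true  = refl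
    contrapositionᵇ false false = refl

    ∧-pairᵇ : ∀ x y → (x ⇒ᵇ y ⇒ᵇ x ∧ y) ≡ true
    ∧-pairᵇ true  true  = refl
    ∧-pairᵇ true  false = refl
    ∧-pairᵇ false true  = refl
    ∧-pairᵇ false false = refl

    uncurryᵇ : ∀ x y z → ((x ⇒ᵇ y ⇒ᵇ z) ⇒ᵇ x ∧ y ⇒ᵇ z) ≡ true
    uncurryᵇ true  true  true  = refl
    uncurryᵇ true  true  false = refl
    uncurryᵇ true  false true  = refl
    uncurryᵇ true  false false = refl
    uncurryᵇ false true  true  = refl
    uncurryᵇ false true  false = refl
    uncurryᵇ false false true  = refl
    uncurryᵇ false false false = refl

  ⇒-refl : ⊢S (φ ⇒ φ)
  ⇒-refl {φ} = taut λ v → ⇒ᵇ-refl (eval v φ)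

  infixr 9 _⨾_

  _⨾_ : ⊢S (φ ⇒ ψ) → ⊢S (ψ ⇒ χ) → ⊢S (φ ⇒ χ)
  _⨾_ {φ} {ψ} {χ} f g = mp (mp (taut λ v → ⇒ᵇ-trans (eval v φ) (eval v ψ) (eval v χ)) f) g

  ⟨_,_⟩ : ⊢S (χ ⇒ φ) → ⊢S (χ ⇒ ψ) → ⊢S (χ ⇒ φ ∧′ ψ)
  ⟨_,_⟩ {χ} {φ} {ψ} f g = mp (mp (taut λ v → ⇒ᵇ-∧-intro (eval v φ) (eval v ψ) (eval v χ)) f) g

  ∧-elimˡ : ⊢S (φ ∧′ ψ ⇒ φ)
  ∧-elimˡ {φ} {ψ} = taut λ v → ∧-elimˡᵇ (eval v φ) (eval v ψ)

  ∧-elimʳ : ⊢S (φ ∧′ ψ ⇒ ψ)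
  ∧-elimʳ {φ} {ψ} = taut λ v → ∧-elimʳᵇ (eval v φ) (eval v ψ)

  contraposition : ⊢S (φ ⇒ ψ) → ⊢S (¬′ ψ ⇒ ¬′ φ)
  contraposition {φ} {ψ} = mp (taut λ v → contrapositionᵇ (eval v φ) (eval v ψ))

  ∧-pair : ⊢S (φ ⇒ ψ ⇒ φ ∧′ ψ)
  ∧-pair {φ} {ψ} = taut λ v → ∧-pairᵇ (eval v φ) (eval v ψ)

  uncurry : ⊢S (φ ⇒ ψ ⇒ χ) → ⊢S (φ ∧′ ψ ⇒ χ)
  uncurry {φ} {ψ} {χ} = mp (taut λ v → uncurryᵇ (eval v φ) (eval v ψ) (eval v χ))

  ⇒-⋀ : {φs : List (Fm Ag)} → All (λ ψ → ⊢S (χ ⇒ ψ)) (φ ∷ φs) → ⊢S (χ ⇒ ⋀ (φ ∷ φs))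
  ⇒-⋀ (p ∷ [])     = p
  ⇒-⋀ (p ∷ q ∷ qs) = ⟨ p , ⇒-⋀ (q ∷ qs) ⟩

  record NormalModality (□ : Fm Ag → Fm Ag) : Set where
    field
      dist : ∀ φ ψ → ⊢S (□ (φ ⇒ ψ) ⇒ □ φ ⇒ □ ψ)
      nec  : ⊢S φ → ⊢S □ φ

  open NormalModality

  K-normal : ∀ a → NormalModality (K a)
  K-normal a = record { dist = distK a ; nec = necK a }

  B-normal : ∀ a → NormalModality (B a)
  B-normal a = record { dist = distB a ; nec = necB a }

  I-normal : ∀ a → NormalModality (I a)
  I-normal a = record { dist = distI a ; nec = necI a }

  mono : ∀ {□} → NormalModality □ → ⊢S (φ ⇒ ψ) → ⊢S (□ φ ⇒ □ ψ)
  mono {φ} {ψ} □-normal φ⇒ψ = mp (dist □-normal φ ψ) (nec □-normal φ⇒ψ)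

  agglomeration : ∀ {□} → NormalModality □ → ⊢S (□ φ ∧′ □ ψ ⇒ □ (φ ∧′ ψ))
  agglomeration {φ} {ψ} □-normal =
    uncurry (mono □-normal ∧-pair ⨾ dist □-normal ψ (φ ∧′ ψ))

  ImplicationChain : (n : ℕ) → (Fin (suc n) → Fm Ag) → Set
  ImplicationChain n φ = (i : Fin n) → ⊢S (φ (inject₁ i) ⇒ φ (suc i))

  chain-first⇒ : ∀ {n} (φ : Fin (suc n) → Fm Ag) → ImplicationChain n φ
               → ∀ i → ⊢S (φ zero ⇒ φ i)
  chain-first⇒ φ chain zero = ⇒-refl
  chain-first⇒ {suc n} φ chain (suc i) =
    chain zero ⨾ chain-first⇒ (λ j → φ (suc j)) (λ j → chain (suc j)) i

  chain-⇒last : ∀ {n} (φ : Fin (suc n) → Fm Ag) → ImplicationChain n φ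
              → ∀ i → ⊢S (φ i ⇒ φ (fromℕ n))
  chain-⇒last φ chain zero = chain-first⇒ φ chain _
  chain-⇒last {suc n} φ chain (suc i) =
    chain-⇒last (λ j → φ (suc j)) (λ j → chain (suc j)) i

  S-convex : (a b : Ag) {ψ χ ξ : Fm Ag} → ⊢S (ψ ⇒ χ) → ⊢S (χ ⇒ ξ)
           → ⊢S (S a b ψ ∧′ S a b ξ ⇒ S a b χ)
  S-convex a b {ψ} {χ} {ξ} ψ⇒χ χ⇒ξ = ⟨ knowledge , ⟨ belief , intention ⟩ ⟩
    where
    H : Fm Ag
    H = S a b ψ ∧′ S a b ξ

    ¬Kξ⇒¬Kχ : ⊢S (¬′ K b ξ ⇒ ¬′ K b χ)
    ¬Kξ⇒¬Kχ = contraposition (mono (K-normal b) χ⇒ξ)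

    knowledge : ⊢S (H ⇒ K a χ)
    knowledge = ∧-elimˡ ⨾ ∧-elimˡ ⨾ mono (K-normal a) ψ⇒χ

    belief : ⊢S (H ⇒ B a (¬′ K b χ))
    belief = ∧-elimʳ ⨾ ∧-elimʳ ⨾ ∧-elimˡ ⨾ mono (B-normal a) ¬Kξ⇒¬Kχ

    intention : ⊢S (H ⇒ I a (χ ∧′ ¬′ K b χ))
    intention =
      ⟨ ∧-elimˡ ⨾ ∧-elimʳ ⨾ ∧-elimʳ ⨾ mono (I-normal a) (∧-elimˡ ⨾ ψ⇒χ)
      , ∧-elimʳ ⨾ ∧-elimʳ ⨾ ∧-elimʳ ⨾ mono (I-normal a) (∧-elimʳ ⨾ ¬Kξ⇒¬Kχ) ⟩
      ⨾ agglomeration (I-normal a)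

mainTheorem10 : (k : ℕ) (m : ℕ) (φ : Fin (suc (suc m)) → Fm (Fin (suc k))) (a b : Fin (suc k))
    → ((i : Fin (suc m)) → ⊢S (φ (inject₁ i) ⇒ φ (suc i)))
    → ⊢S ((S a b (φ zero) ∧′ S a b (φ (fromℕ (suc m)))) ⇒ ⋀ (map (λ i → S a b (φ i)) (allFin (suc (suc m)))))
mainTheorem10 k m φ a b chain =
  ⇒-⋀ (map⁺ (tabulate⁺ λ i →
    S-convex a b (chain-first⇒ φ chain i) (chain-⇒last φ chain i)))
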